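{- Let $n\ge4$ and let $U_n$ be the array indexed by $[0,n]^3$ that agrees with $M_n$ everywhere except at position $(2,2,2)$, where $(U_n)_{2,2,2}=(M_n)_{2,2,2}-1$. Then $U_n$ is a corner-sum hypermatrix of order $n$, and $\Xi^{ -1}(U_n)$ is not the hypermatrix of a Latin square (i.e. $\Xi^{ -1}(U_n)\neq H(L)$ for every Latin square $L$ of order $n$).
   Context: $M_n$ is the array indexed by $[0,n]^3$ with $(M_n)_{i,j,k}=\min\big(k\min(i,j),\ ij-(n-k)\max(0,i+j-n)\big)$. A corner-sum hypermatrix of order $n$ is an integer array $C$ indexed by $[0,n]^3$ with $C_{i,j,0}=C_{i,0,j}=C_{0,i,j}=0$, $C_{i,j,n}=C_{i,n,j}=C_{n,i,j}=ij$ for all $i,j\in[0,n]$, and for all $i,j\in[0,n]$, $1\le k\le n$, each of $C_{i,j,k}-C_{i,j,k-1}$, $C_{i,k,j}-C_{i,k-1,j}$, $C_{k,i,j}-C_{k-1,i,j}$ in $\{\max(0,i+j-n),\dots,\min(i,j)\}$. For $C$ indexed by $[0,n]^3$, $\Xi^{ -1}(C)_{i,j,k}=C_{i,j,k}-C_{i-1,j,k}-C_{i,j-1,k}-C_{i,j,k-1}+C_{i-1,j-1,k}+C_{i-1,j,k-1}+C_{i,j-1,k-1}-C_{i-1,j-1,k-1}$ for $i,j,k\in[n]$. For a Latin square $L$ of order $n$ on symbols $[n]$, $H(L)$ is the $n\times n\times n$ $(0,1)$-hypermatrix with $H(L)_{i,j,k}=1$ iff $L_{i,j}=k$. -}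

module Defs where

open import Data.Nat as ℕ using (ℕ; zero; suc; _∸_; _≤_; _≡ᵇ_)
open import Data.Integer as ℤ using (ℤ; +_; _-_; _+_; _*_; _⊓_)
open import Data.Fin using (Fin; toℕ)
open import Data.Product using (_×_)
open import Function.Definitions using (Injective)
open import Relation.Binary.PropositionalEquality using (_≡_)
open import Relation.Nullary.Decidable using (⌊_⌋)
open import Data.Fin.Properties using () renaming (_≟_ to _≟ᶠ_)
open import Data.Bool using (if_then_else_)

-- Arrays indexed by [0,n]^3 are represented as functions ℕ → ℕ → ℕ → ℤ;
-- only entries with all indices ≤ n are ever constrained or used.
Array3 : Set
Array3 = ℕ → ℕ → ℕ → ℤ

M : ℕ → Array3
M n i j k = (+ (k ℕ.* (i ℕ.⊓ j))) ⊓ ((+ (i ℕ.* j)) - (+ ((n ∸ k) ℕ.* ((i ℕ.+ j) ∸ n))))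

U : ℕ → Array3
U n i j k =
  if (i ≡ᵇ 2) Data.Bool.∧ (j ≡ᵇ 2) Data.Bool.∧ (k ≡ᵇ 2)
  then M n i j k - + 1
  else M n i j k

InRange : ℕ → ℕ → ℕ → ℤ → Set
InRange n i j d = (+ ((i ℕ.+ j) ∸ n) ℤ.≤ d) × (d ℤ.≤ + (i ℕ.⊓ j))

record IsCornerSum (n : ℕ) (C : Array3) : Set where
  field
    zero₃ : ∀ i j → i ≤ n → j ≤ n → C i j 0 ≡ + 0
    zero₂ : ∀ i j → i ≤ n → j ≤ n → C i 0 j ≡ + 0
    zero₁ : ∀ i j → i ≤ n → j ≤ n → C 0 i j ≡ + 0
    full₃ : ∀ i j → i ≤ n → j ≤ n → C i j n ≡ + (i ℕ.* j)
    full₂ : ∀ i j → i ≤ n → j ≤ n → C i n j ≡ + (i ℕ.* j)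
    full₁ : ∀ i j → i ≤ n → j ≤ n → C n i j ≡ + (i ℕ.* j)
    step₃ : ∀ i j k → i ≤ n → j ≤ n → 1 ≤ k → k ≤ n →
            InRange n i j (C i j k - C i j (k ∸ 1))
    step₂ : ∀ i j k → i ≤ n → j ≤ n → 1 ≤ k → k ≤ n →
            InRange n i j (C i k j - C i (k ∸ 1) j)
    step₁ : ∀ i j k → i ≤ n → j ≤ n → 1 ≤ k → k ≤ n →
            InRange n i j (C k i j - C (k ∸ 1) i j)

-- Ξ^{-1}(C)_{i,j,k} for i,j,k ∈ [n] (used with i,j,k ≥ 1)
Ξinv : Array3 → Array3
Ξinv C i j k =
  C i j k - C (i ∸ 1) j k - C i (j ∸ 1) k - C i j (k ∸ 1)
  + C (i ∸ 1) (j ∸ 1) k + C (i ∸ 1) j (k ∸ 1) + C i (j ∸ 1) (k ∸ 1)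
  - C (i ∸ 1) (j ∸ 1) (k ∸ 1)

-- A Latin square of order n: rows/columns/symbols are [n], represented by
-- Fin n (element r : Fin n stands for toℕ r + 1); no symbol repeats in any
-- row or column.
IsLatinSquare : (n : ℕ) → (Fin n → Fin n → Fin n) → Set
IsLatinSquare n L = (∀ i → Injective _≡_ _≡_ (L i))
                  × (∀ j → Injective _≡_ _≡_ (λ i → L i j))

H : {n : ℕ} → (Fin n → Fin n → Fin n) → Fin n → Fin n → Fin n → ℤ
H L i j k = if ⌊ L i j ≟ᶠ k ⌋ then + 1 else + 0

ΞinvFin : (n : ℕ) → Array3 → Fin n → Fin n → Fin n → ℤ
ΞinvFin n C i j k = Ξinv C (suc (toℕ i)) (suc (toℕ j)) (suc (toℕ k))

-- For k ≤ n the entry (M_n)_{i,j,k} is the minimum of ki, kj, ij and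
-- ij + jk + ki − n(i + j + k) + n², so M_n is symmetric in its three indices, and raising k by one
-- raises it by an amount between max(0, i + j − n) and min(i, j). Hence M_n is a corner-sum
-- hypermatrix; lowering the entry at (2,2,2) turns the values 2, 4, 4 at k = 1, 2, 3 into 2, 3, 4,
-- whose steps stay in [0, 2]. But Ξ⁻¹(M_n) vanishes at (2,2,2), so Ξ⁻¹(U_n) has the entry −1
-- there, which no (0,1)-hypermatrix has.
module Submission where

open import Defs
open import Data.Nat as ℕ using (ℕ; _≤_; suc; z≤n; s≤s; _∸_; _≡ᵇ_)
import Data.Nat.Properties as ℕ
open import Data.Integer as ℤ using (ℤ; +_; -[1+_]; +≤+; _+_; _-_; _*_; _⊓_)
import Data.Integer.Properties as ℤ
open import Data.Integer.Tactic.RingSolver using (solve-∀)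
open import Data.Fin as Fin using (Fin)
import Data.Fin.Properties as Fin
open import Data.Bool using (Bool; true; false; T; _∧_; if_then_else_)
open import Data.Bool.Properties using (T-∧; ∧-commutativeMonoid)
open import Data.Product using (_×_; _,_; proj₁; proj₂)
open import Data.Sum using (inj₁; inj₂)
open import Data.Unit using (tt)
open import Data.Empty using (⊥-elim)
open import Algebra.Bundles using (CommutativeMonoid)
open import Algebra.Properties.CommutativeSemigroup ℤ.⊓-commutativeSemigroup
  using () renaming (interchange to ⊓-interchange)
open import Algebra.Properties.CommutativeSemigroup (CommutativeMonoid.commutativeSemigroup ∧-commutativeMonoid)
  using () renaming (x∙yz≈y∙xz to ∧-swap₁₂; x∙yz≈z∙yx to ∧-swap₁₃)
open import Function using (_∘_)
open import Function.Bundles using (Equivalence)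
open import Relation.Nullary using (¬_; yes; no)
open import Relation.Binary.PropositionalEquality
  using (_≡_; _≢_; refl; sym; trans; cong; cong₂; subst; module ≡-Reasoning)

pos-∸ : ∀ {i j} → j ≤ i → + (i ∸ j) ≡ + i - + j
pos-∸ {i} {j} j≤i = trans (sym (ℤ.≤-⊖ j≤i)) (sym (ℤ.m-n≡m⊖n i j))

[x+a]-x≡a : ∀ x a → (x + a) - x ≡ a
[x+a]-x≡a = solve-∀

x-c*[s-t]≡x+c*[t-s] : ∀ x c s t → x - c * (s - t) ≡ x + c * (t - s)
x-c*[s-t]≡x+c*[t-s] = solve-∀

x-[a+y]+a≡x-y : ∀ x a y → x - (a + y) + a ≡ x - y
x-[a+y]+a≡x-y = solve-∀

⊓-distribʳ-+ : ∀ p q c → (p + c) ⊓ (q + c) ≡ (p ⊓ q) + c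
⊓-distribʳ-+ p q c = sym (ℤ.mono-≤-distrib-⊓ (ℤ.+-monoˡ-≤ c) p q)

⊓-increment-bounds : ∀ p q {a b} → a ℤ.≤ b →
  a ℤ.≤ ((p + b) ⊓ (q + a)) - (p ⊓ q) × ((p + b) ⊓ (q + a)) - (p ⊓ q) ℤ.≤ b
⊓-increment-bounds p q {a} {b} a≤b = lower , upper
  where
    x : ℤ
    x = (p + b) ⊓ (q + a)
    lower : a ℤ.≤ x - (p ⊓ q)
    lower = subst (ℤ._≤ x - (p ⊓ q)) ([x+a]-x≡a (p ⊓ q) a)
      (ℤ.+-monoˡ-≤ (ℤ.- (p ⊓ q))
        (subst (ℤ._≤ x) (⊓-distribʳ-+ p q a) (ℤ.⊓-monoˡ-≤ (q + a) (ℤ.+-monoʳ-≤ p a≤b))))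
    upper : x - (p ⊓ q) ℤ.≤ b
    upper = subst (x - (p ⊓ q) ℤ.≤_) ([x+a]-x≡a (p ⊓ q) b)
      (ℤ.+-monoˡ-≤ (ℤ.- (p ⊓ q))
        (subst (x ℤ.≤_) (⊓-distribʳ-+ p q b) (ℤ.⊓-monoʳ-≤ (p + b) (ℤ.+-monoʳ-≤ q a≤b))))

x-c*[s∸t]≡x⊓[x-c*[s-t]] : ∀ x c s t →
  + x - + (c ℕ.* (s ∸ t)) ≡ + x ⊓ (+ x - + c * (+ s - + t))
x-c*[s∸t]≡x⊓[x-c*[s-t]] x c s t with ℕ.≤-total s t
... | inj₁ s≤t = begin
  + x - + (c ℕ.* (s ∸ t))        ≡⟨ cong (λ d → + x - + (c ℕ.* d)) (ℕ.m≤n⇒m∸n≡0 s≤t) ⟩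
  + x - + (c ℕ.* 0)              ≡⟨ cong (λ d → + x - + d) (ℕ.*-zeroʳ c) ⟩
  + x - + 0                      ≡⟨ ℤ.+-identityʳ (+ x) ⟩
  + x                            ≡⟨ ℤ.i≤j⇒i⊓j≡i (subst (+ x ℤ.≤_) (sym y≡x+d) (ℤ.i≤i+j (+ x) (+ d))) ⟨
  + x ⊓ y                        ∎
  where
    open ≡-Reasoning
    y : ℤ
    y = + x - + c * (+ s - + t)
    d : ℕ
    d = c ℕ.* (t ∸ s)
    y≡x+d : y ≡ + x + + d
    y≡x+d = begin
      + x - + c * (+ s - + t)    ≡⟨ x-c*[s-t]≡x+c*[t-s] (+ x) (+ c) (+ s) (+ t) ⟩
      + x + + c * (+ t - + s)    ≡⟨ cong (λ e → + x + + c * e) (pos-∸ s≤t) ⟨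
      + x + + c * + (t ∸ s)      ≡⟨ cong (λ e → + x + e) (ℤ.pos-* c (t ∸ s)) ⟨
      + x + + d                  ∎
... | inj₂ t≤s = begin
  + x - + d                      ≡⟨ ℤ.i≥j⇒i⊓j≡j (ℤ.i-j≤i (+ x) (+ d)) ⟨
  + x ⊓ (+ x - + d)              ≡⟨ cong (λ e → + x ⊓ (+ x - e)) d≡c*[s-t] ⟩
  + x ⊓ (+ x - + c * (+ s - + t)) ∎
  where
    open ≡-Reasoning
    d : ℕ
    d = c ℕ.* (s ∸ t)
    d≡c*[s-t] : + d ≡ + c * (+ s - + t)
    d≡c*[s-t] = trans (ℤ.pos-* c (s ∸ t)) (cong (+ c *_) (pos-∸ t≤s))

m+n∸o≤m⊓n : ∀ {m n o} → m ≤ o → n ≤ o → (m ℕ.+ n) ∸ o ≤ m ℕ.⊓ n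
m+n∸o≤m⊓n {m} {n} {o} m≤o n≤o = ℕ.⊓-glb
  (ℕ.≤-trans (ℕ.∸-monoˡ-≤ o (ℕ.+-monoʳ-≤ m n≤o)) (ℕ.≤-reflexive (ℕ.m+n∸n≡m m o)))
  (ℕ.≤-trans (ℕ.∸-monoˡ-≤ o (ℕ.+-monoˡ-≤ n m≤o)) (ℕ.≤-reflexive (ℕ.m+n∸m≡n o n)))

m*n≤o*[m⊓n] : ∀ {m n o} → m ≤ o → n ≤ o → m ℕ.* n ≤ o ℕ.* (m ℕ.⊓ n)
m*n≤o*[m⊓n] {m} {n} {o} m≤o n≤o with ℕ.≤-total m n
... | inj₁ m≤n rewrite ℕ.m≤n⇒m⊓n≡m m≤n | ℕ.*-comm m n = ℕ.*-monoˡ-≤ m n≤o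
... | inj₂ n≤m rewrite ℕ.m≥n⇒m⊓n≡n n≤m = ℕ.*-monoˡ-≤ n m≤o

-- The second argument of the min defining M, without the truncation max(0, i + j − n).
Q : ℤ → ℤ → ℤ → ℤ → ℤ
Q N I J K = I * J - (N - K) * ((I + J) - N)

-- Both sides equal IJ + JK + KI − N(I + J + K) + N².
Q-swap₁₃ : ∀ N I J K → Q N I J K ≡ Q N K J I
Q-swap₁₃ = identity
  where
    identity : ∀ N I J K → I * J - (N - K) * ((I + J) - N) ≡ K * J - (N - I) * ((K + J) - N)
    identity = solve-∀

Q-at-zero : ∀ N I J → Q N I J (+ 0) ≡ (N - I) * (N - J)
Q-at-zero = identity
  where
    identity : ∀ N I J → I * J - (N - + 0) * ((I + J) - N) ≡ (N - I) * (N - J)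
    identity = solve-∀

minOfFour : ℤ → ℤ → ℤ → ℤ → ℤ
minOfFour N I J K = ((K * I) ⊓ (K * J)) ⊓ ((I * J) ⊓ Q N I J K)

minOfFour-swap₁₃ : ∀ N I J K → minOfFour N I J K ≡ minOfFour N K J I
minOfFour-swap₁₃ N I J K = begin
  ((K * I) ⊓ (K * J)) ⊓ ((I * J) ⊓ Q N I J K) ≡⟨ ⊓-interchange (K * I) (K * J) (I * J) (Q N I J K) ⟩
  ((K * I) ⊓ (I * J)) ⊓ ((K * J) ⊓ Q N I J K)
    ≡⟨ cong₂ (λ KI Q′ → (KI ⊓ (I * J)) ⊓ ((K * J) ⊓ Q′)) (ℤ.*-comm K I) (Q-swap₁₃ N I J K) ⟩
  ((I * K) ⊓ (I * J)) ⊓ ((K * J) ⊓ Q N K J I) ∎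
  where open ≡-Reasoning

M≡minOfFour : ∀ {n i j k} → k ≤ n → M n i j k ≡ minOfFour (+ n) (+ i) (+ j) (+ k)
M≡minOfFour {n} {i} {j} {k} k≤n = cong₂ _⊓_ first second
  where
    open ≡-Reasoning
    first : + (k ℕ.* (i ℕ.⊓ j)) ≡ (+ k * + i) ⊓ (+ k * + j)
    first = trans (cong +_ (ℕ.*-distribˡ-⊓ k i j)) (cong₂ _⊓_ (ℤ.pos-* k i) (ℤ.pos-* k j))
    second : + (i ℕ.* j) - + ((n ∸ k) ℕ.* ((i ℕ.+ j) ∸ n)) ≡ (+ i * + j) ⊓ Q (+ n) (+ i) (+ j) (+ k)
    second = begin
      + (i ℕ.* j) - + ((n ∸ k) ℕ.* ((i ℕ.+ j) ∸ n))
        ≡⟨ x-c*[s∸t]≡x⊓[x-c*[s-t]] (i ℕ.* j) (n ∸ k) (i ℕ.+ j) n ⟩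
      + (i ℕ.* j) ⊓ (+ (i ℕ.* j) - + (n ∸ k) * (+ (i ℕ.+ j) - + n))
        ≡⟨ cong (λ ij → ij ⊓ (ij - + (n ∸ k) * (+ (i ℕ.+ j) - + n))) (ℤ.pos-* i j) ⟩
      (+ i * + j) ⊓ (+ i * + j - + (n ∸ k) * (+ (i ℕ.+ j) - + n))
        ≡⟨ cong₂ (λ n-k i+j → (+ i * + j) ⊓ (+ i * + j - n-k * (i+j - + n))) (pos-∸ k≤n) (ℤ.pos-+ i j) ⟩
      (+ i * + j) ⊓ Q (+ n) (+ i) (+ j) (+ k) ∎

M-swap₁₂ : ∀ n i j k → M n i j k ≡ M n j i k
M-swap₁₂ n i j k rewrite ℕ.⊓-comm i j | ℕ.*-comm i j | ℕ.+-comm i j = refl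

M-swap₁₃ : ∀ {n i j k} → i ≤ n → k ≤ n → M n i j k ≡ M n k j i
M-swap₁₃ {n} {i} {j} {k} i≤n k≤n = begin
  M n i j k                         ≡⟨ M≡minOfFour k≤n ⟩
  minOfFour (+ n) (+ i) (+ j) (+ k) ≡⟨ minOfFour-swap₁₃ (+ n) (+ i) (+ j) (+ k) ⟩
  minOfFour (+ n) (+ k) (+ j) (+ i) ≡⟨ M≡minOfFour i≤n ⟨
  M n k j i                         ∎
  where open ≡-Reasoning

M-zero : ∀ {n i j} → i ≤ n → j ≤ n → M n i j 0 ≡ + 0
M-zero {n} {i} {j} i≤n j≤n =
  trans (M≡minOfFour {n} {i} {j} z≤n) (ℤ.i≤j⇒i⊓j≡i (ℤ.⊓-glb 0≤ij 0≤Q))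
  where
    0≤ij : + 0 ℤ.≤ + i * + j
    0≤ij = subst (+ 0 ℤ.≤_) (ℤ.pos-* i j) (+≤+ z≤n)
    0≤Q : + 0 ℤ.≤ Q (+ n) (+ i) (+ j) (+ 0)
    0≤Q = subst (+ 0 ℤ.≤_) (sym (begin
      Q (+ n) (+ i) (+ j) (+ 0)   ≡⟨ Q-at-zero (+ n) (+ i) (+ j) ⟩
      (+ n - + i) * (+ n - + j)   ≡⟨ cong₂ _*_ (pos-∸ i≤n) (pos-∸ j≤n) ⟨
      + (n ∸ i) * + (n ∸ j)       ≡⟨ ℤ.pos-* (n ∸ i) (n ∸ j) ⟨
      + ((n ∸ i) ℕ.* (n ∸ j))     ∎)) (+≤+ z≤n)
      where open ≡-Reasoning

M-full : ∀ {n i j} → i ≤ n → j ≤ n → M n i j n ≡ + (i ℕ.* j)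
M-full {n} {i} {j} i≤n j≤n = begin
  M n i j n
    ≡⟨ cong (λ d → + (n ℕ.* (i ℕ.⊓ j)) ⊓ (+ (i ℕ.* j) - + (d ℕ.* ((i ℕ.+ j) ∸ n)))) (ℕ.n∸n≡0 n) ⟩
  + (n ℕ.* (i ℕ.⊓ j)) ⊓ (+ (i ℕ.* j) - + 0)
    ≡⟨ cong (+ (n ℕ.* (i ℕ.⊓ j)) ⊓_) (ℤ.+-identityʳ (+ (i ℕ.* j))) ⟩
  + (n ℕ.* (i ℕ.⊓ j) ℕ.⊓ (i ℕ.* j))
    ≡⟨ cong +_ (ℕ.m≥n⇒m⊓n≡n (m*n≤o*[m⊓n] i≤n j≤n)) ⟩
  + (i ℕ.* j) ∎
  where open ≡-Reasoning

-- Raising k by one adds min(i, j) to the first argument of the min defining M and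
-- max(0, i + j − n) to the second.
M-step : ∀ {n i j k} → i ≤ n → j ≤ n → 1 ≤ k → k ≤ n → InRange n i j (M n i j k - M n i j (k ∸ 1))
M-step {n} {i} {j} {suc k} i≤n j≤n _ k<n =
  subst (λ x → InRange n i j (x - (p ⊓ q))) (sym (cong₂ _⊓_ first second))
    (⊓-increment-bounds p q (+≤+ (m+n∸o≤m⊓n i≤n j≤n)))
  where
    open ≡-Reasoning
    a b : ℕ
    a = (i ℕ.+ j) ∸ n
    b = i ℕ.⊓ j
    p q : ℤ
    p = + (k ℕ.* b)
    q = + (i ℕ.* j) - + ((n ∸ k) ℕ.* a)
    first : + (suc k ℕ.* b) ≡ p + + b
    first = trans (ℤ.pos-+ b (k ℕ.* b)) (ℤ.+-comm (+ b) p)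
    second : + (i ℕ.* j) - + ((n ∸ suc k) ℕ.* a) ≡ q + + a
    second = begin
      + (i ℕ.* j) - + ((n ∸ suc k) ℕ.* a)
        ≡⟨ x-[a+y]+a≡x-y (+ (i ℕ.* j)) (+ a) (+ ((n ∸ suc k) ℕ.* a)) ⟨
      + (i ℕ.* j) - (+ a + + ((n ∸ suc k) ℕ.* a)) + + a
        ≡⟨ cong (λ c → + (i ℕ.* j) - c + + a) (ℤ.pos-+ a ((n ∸ suc k) ℕ.* a)) ⟨
      + (i ℕ.* j) - + (suc (n ∸ suc k) ℕ.* a) + + a
        ≡⟨ cong (λ c → + (i ℕ.* j) - + (c ℕ.* a) + + a) (ℕ.+-∸-assoc 1 k<n) ⟨
      q + + a ∎

record Symmetric (n : ℕ) (C : Array3) : Set where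
  field
    swap₁₂ : ∀ {i j k} → i ≤ n → j ≤ n → k ≤ n → C i j k ≡ C j i k
    swap₁₃ : ∀ {i j k} → i ≤ n → j ≤ n → k ≤ n → C i j k ≡ C k j i

  swap₂₃ : ∀ {i j k} → i ≤ n → j ≤ n → k ≤ n → C i j k ≡ C i k j
  swap₂₃ i≤n j≤n k≤n = trans (swap₁₂ i≤n j≤n k≤n) (trans (swap₁₃ j≤n i≤n k≤n) (swap₁₂ k≤n i≤n j≤n))

  rotate : ∀ {i j k} → i ≤ n → j ≤ n → k ≤ n → C k i j ≡ C i j k
  rotate i≤n j≤n k≤n = trans (swap₁₃ k≤n i≤n j≤n) (swap₁₂ j≤n i≤n k≤n)

symmetric⇒isCornerSum : ∀ {n C} → Symmetric n C →
  (∀ i j → i ≤ n → j ≤ n → C i j 0 ≡ + 0) →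
  (∀ i j → i ≤ n → j ≤ n → C i j n ≡ + (i ℕ.* j)) →
  (∀ i j k → i ≤ n → j ≤ n → 1 ≤ k → k ≤ n → InRange n i j (C i j k - C i j (k ∸ 1))) →
  IsCornerSum n C
symmetric⇒isCornerSum {n} {C} C-sym zero₃ full₃ step₃ = record
  { zero₃ = zero₃
  ; zero₂ = λ i j i≤n j≤n → trans (swap₂₃ i≤n z≤n j≤n) (zero₃ i j i≤n j≤n)
  ; zero₁ = λ i j i≤n j≤n → trans (rotate i≤n j≤n z≤n) (zero₃ i j i≤n j≤n)
  ; full₃ = full₃
  ; full₂ = λ i j i≤n j≤n → trans (swap₂₃ i≤n ℕ.≤-refl j≤n) (full₃ i j i≤n j≤n)
  ; full₁ = λ i j i≤n j≤n → trans (rotate i≤n j≤n ℕ.≤-refl) (full₃ i j i≤n j≤n)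
  ; step₃ = step₃
  ; step₂ = λ i j k i≤n j≤n 1≤k k≤n → subst (InRange n i j)
      (sym (cong₂ _-_ (swap₂₃ i≤n k≤n j≤n) (swap₂₃ i≤n (k∸1≤n k≤n) j≤n)))
      (step₃ i j k i≤n j≤n 1≤k k≤n)
  ; step₁ = λ i j k i≤n j≤n 1≤k k≤n → subst (InRange n i j)
      (sym (cong₂ _-_ (rotate i≤n j≤n k≤n) (rotate i≤n j≤n (k∸1≤n k≤n))))
      (step₃ i j k i≤n j≤n 1≤k k≤n)
  }
  where
    open Symmetric C-sym
    k∸1≤n : ∀ {k} → k ≤ n → k ∸ 1 ≤ n
    k∸1≤n {k} = ℕ.≤-trans (ℕ.m∸n≤m k 1)

M-symmetric : ∀ n → Symmetric n (M n)
M-symmetric n = record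
  { swap₁₂ = λ {i} {j} {k} _ _ _ → M-swap₁₂ n i j k
  ; swap₁₃ = λ i≤n _ k≤n → M-swap₁₃ i≤n k≤n
  }

isCorner : ℕ → ℕ → ℕ → Bool
isCorner i j k = (i ≡ᵇ 2) ∧ (j ≡ᵇ 2) ∧ (k ≡ᵇ 2)

isCorner⇒≡ : ∀ {i j k} → isCorner i j k ≡ true → (i , j , k) ≡ (2 , 2 , 2)
isCorner⇒≡ {i} {j} {k} corner with Equivalence.to (T-∧ {i ≡ᵇ 2}) (subst T (sym corner) tt)
... | i≡2 , jk≡2 with Equivalence.to (T-∧ {j ≡ᵇ 2}) jk≡2
...   | j≡2 , k≡2 = cong₂ _,_ (ℕ.≡ᵇ⇒≡ i 2 i≡2) (cong₂ _,_ (ℕ.≡ᵇ⇒≡ j 2 j≡2) (ℕ.≡ᵇ⇒≡ k 2 k≡2))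

U≡M : ∀ {n i j k} → (i , j , k) ≢ (2 , 2 , 2) → U n i j k ≡ M n i j k
U≡M {n} {i} {j} {k} ≢corner with isCorner i j k in corner
... | false = refl
... | true  = ⊥-elim (≢corner (isCorner⇒≡ corner))

U-symmetric : ∀ n → Symmetric n (U n)
U-symmetric n = record
  { swap₁₂ = λ {i} {j} {k} i≤n j≤n k≤n →
      cong₂ decrementIf (∧-swap₁₂ (i ≡ᵇ 2) (j ≡ᵇ 2) (k ≡ᵇ 2)) (swap₁₂ i≤n j≤n k≤n)
  ; swap₁₃ = λ {i} {j} {k} i≤n j≤n k≤n →
      cong₂ decrementIf (∧-swap₁₃ (i ≡ᵇ 2) (j ≡ᵇ 2) (k ≡ᵇ 2)) (swap₁₃ i≤n j≤n k≤n)
  }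
  where
    open Symmetric (M-symmetric n)
    decrementIf : Bool → ℤ → ℤ
    decrementIf b x = if b then x - + 1 else x

U-zero : ∀ {n} i j → i ≤ n → j ≤ n → U n i j 0 ≡ + 0
U-zero {n} i j i≤n j≤n = trans (U≡M {n} {i} {j} {0} (λ ())) (M-zero i≤n j≤n)

U-full : ∀ {n} → 4 ≤ n → ∀ i j → i ≤ n → j ≤ n → U n i j n ≡ + (i ℕ.* j)
U-full {n} 4≤n i j i≤n j≤n = trans (U≡M {n} {i} {j} {n} (n≢2 ∘ cong (proj₂ ∘ proj₂))) (M-full i≤n j≤n)
  where
    n≢2 : n ≢ 2
    n≢2 = ℕ.>⇒≢ (ℕ.≤-trans (s≤s (s≤s (s≤s z≤n))) 4≤n)

-- In these two computations every entry involved has i + j ≤ 4 ≤ n, so the truncated term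
-- max(0, i + j − n) vanishes.
U-corner-steps : ∀ {n} → 4 ≤ n →
  InRange n 2 2 (U n 2 2 2 - U n 2 2 1) × InRange n 2 2 (U n 2 2 3 - U n 2 2 2)
U-corner-steps (s≤s (s≤s (s≤s (s≤s (z≤n {m}))))) rewrite ℕ.0∸n≡0 m | ℕ.*-zeroʳ m =
  (+≤+ z≤n , +≤+ (s≤s z≤n)) , (+≤+ z≤n , +≤+ (s≤s z≤n))

U-Ξinv-corner : ∀ {n} → 4 ≤ n → Ξinv (U n) 2 2 2 ≡ -[1+ 0 ]
U-Ξinv-corner (s≤s (s≤s (s≤s (s≤s (z≤n {m}))))) rewrite ℕ.0∸n≡0 m | ℕ.*-zeroʳ m = refl

U-step-offCorner : ∀ {n i j k} → (i , j , k) ≢ (2 , 2 , 2) → (i , j , k ∸ 1) ≢ (2 , 2 , 2) →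
  i ≤ n → j ≤ n → 1 ≤ k → k ≤ n → InRange n i j (U n i j k - U n i j (k ∸ 1))
U-step-offCorner {n} {i} {j} {k} off off′ i≤n j≤n 1≤k k≤n =
  subst (InRange n i j) (sym (cong₂ _-_ (U≡M {n} off) (U≡M {n} off′))) (M-step i≤n j≤n 1≤k k≤n)

U-step : ∀ {n} → 4 ≤ n → ∀ i j k → i ≤ n → j ≤ n → 1 ≤ k → k ≤ n →
  InRange n i j (U n i j k - U n i j (k ∸ 1))
U-step {n} 4≤n i j k i≤n j≤n 1≤k k≤n with i ℕ.≟ 2 | j ℕ.≟ 2
... | no i≢2 | _ = U-step-offCorner (i≢2 ∘ cong proj₁) (i≢2 ∘ cong proj₁) i≤n j≤n 1≤k k≤n
... | yes _ | no j≢2 =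
  U-step-offCorner (j≢2 ∘ cong (proj₁ ∘ proj₂)) (j≢2 ∘ cong (proj₁ ∘ proj₂)) i≤n j≤n 1≤k k≤n
... | yes refl | yes refl = corner k 1≤k k≤n
  where
    corner : ∀ k → 1 ≤ k → k ≤ n → InRange n 2 2 (U n 2 2 k - U n 2 2 (k ∸ 1))
    corner 1 1≤k k≤n = U-step-offCorner (λ ()) (λ ()) i≤n j≤n 1≤k k≤n
    corner 2 _ _ = proj₁ (U-corner-steps 4≤n)
    corner 3 _ _ = proj₂ (U-corner-steps 4≤n)
    corner (suc (suc (suc (suc _)))) 1≤k k≤n = U-step-offCorner (λ ()) (λ ()) i≤n j≤n 1≤k k≤n

U-isCornerSum : ∀ {n} → 4 ≤ n → IsCornerSum n (U n)
U-isCornerSum {n} 4≤n = symmetric⇒isCornerSum (U-symmetric n) U-zero (U-full 4≤n) (U-step 4≤n)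

H-nonneg : ∀ {n} (L : Fin n → Fin n → Fin n) i j k → + 0 ℤ.≤ H L i j k
H-nonneg L i j k with L i j Fin.≟ k
... | yes _ = +≤+ z≤n
... | no _  = +≤+ z≤n

ΞinvFin-negative⇒≢H : ∀ {n} C (L : Fin n → Fin n → Fin n) i j k → ΞinvFin n C i j k ℤ.< + 0 →
  ¬ (∀ i j k → ΞinvFin n C i j k ≡ H L i j k)
ΞinvFin-negative⇒≢H C L i j k negative Ξ≡H =
  ℤ.<⇒≱ negative (subst (+ 0 ℤ.≤_) (sym (Ξ≡H i j k)) (H-nonneg L i j k))

mainTheorem18 : (n : ℕ) → 4 ≤ n →
    IsCornerSum n (U n)
    × ((L : Fin n → Fin n → Fin n) → IsLatinSquare n L →
    ¬ (∀ i j k → ΞinvFin n (U n) i j k ≡ H L i j k))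
mainTheorem18 n 4≤n = U-isCornerSum 4≤n , λ L _ → ΞinvFin-negative⇒≢H (U n) L two two two ΞU<0
  where
    1<n : 1 ℕ.< n
    1<n = ℕ.≤-trans (s≤s (s≤s z≤n)) 4≤n
    two : Fin n
    two = Fin.fromℕ< 1<n
    ΞU<0 : ΞinvFin n (U n) two two two ℤ.< + 0
    ΞU<0 = subst (ℤ._< + 0) (sym (trans index≡2 (U-Ξinv-corner 4≤n))) ℤ.-<+
      where
        index≡2 : ΞinvFin n (U n) two two two ≡ Ξinv (U n) 2 2 2
        index≡2 = cong (λ t → Ξinv (U n) (suc t) (suc t) (suc t)) (Fin.toℕ-fromℕ< 1<n)
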